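{- For every positive integer $t$, the crown graph $H_t$ satisfies $\mathrm{lbc}(H_t)\ge \frac{1}{2}\lceil \log t\rceil$.
   Context: $\log$ denotes $\log_2$. The crown graph $H_t$ has vertices $u^1,\dots,u^t,v^1,\dots,v^t$, with $u^iv^j$ an edge iff $i\ne j$, and no other edges (i.e. $K_{t,t}$ minus a perfect matching). A biclique of a graph is a complete bipartite subgraph; a biclique cover of $G$ is a collection of bicliques of $G$ whose edge sets have union $E(G)$; it is $r$-local if every vertex lies in at most $r$ of its bicliques. $\mathrm{lbc}(G)$ is the least $r$ such that $G$ has an $r$-local biclique cover. -}

module Defs where

open import Data.Nat using (ℕ; _≤_)
open import Data.Fin using (Fin)
open import Data.Bool using (Bool; true; _∨_)
open import Data.Sum using (_⊎_; inj₁; inj₂)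
open import Data.Product using (_×_; ∃-syntax)
open import Data.List using (List; length; filterᵇ)
open import Data.List.Membership.Propositional using (_∈_)
open import Relation.Binary.PropositionalEquality using (_≡_)
open import Relation.Nullary using (¬_)
open import Data.Empty using (⊥)

record Graph : Set₁ where
  field
    V   : Set
    Adj : V → V → Set
open Graph public

-- The crown graph H_t: vertices u^i = inj₁ i, v^j = inj₂ j (i, j : Fin t);
-- u^i v^j adjacent iff i ≠ j (symmetric), no other edges.
CrownAdj : (t : ℕ) → (Fin t ⊎ Fin t) → (Fin t ⊎ Fin t) → Set
CrownAdj t (inj₁ i) (inj₂ j) = ¬ (i ≡ j)
CrownAdj t (inj₂ j) (inj₁ i) = ¬ (i ≡ j)
CrownAdj t (inj₁ _) (inj₁ _) = ⊥
CrownAdj t (inj₂ _) (inj₂ _) = ⊥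

Crown : ℕ → Graph
Crown t = record { V = Fin t ⊎ Fin t ; Adj = CrownAdj t }

record Biclique (G : Graph) : Set where
  field
    sideA    : V G → Bool
    sideB    : V G → Bool
    complete : ∀ x y → sideA x ≡ true → sideB y ≡ true → Adj G x y
open Biclique public

EdgeIn : {G : Graph} → Biclique G → V G → V G → Set
EdgeIn b x y = (sideA b x ≡ true × sideB b y ≡ true)
             ⊎ (sideA b y ≡ true × sideB b x ≡ true)

inB : {G : Graph} → Biclique G → V G → Bool
inB b x = sideA b x ∨ sideB b x

IsBicliqueCover : (G : Graph) → List (Biclique G) → Set
IsBicliqueCover G C = ∀ x y → Adj G x y → ∃[ b ] (b ∈ C × EdgeIn b x y)

IsLocal : (G : Graph) → ℕ → List (Biclique G) → Set
IsLocal G r C = ∀ (x : V G) → length (filterᵇ (λ b → inB b x) C) ≤ r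

HasLocalCover : Graph → ℕ → Set
HasLocalCover G r = ∃[ C ] (IsBicliqueCover G C × IsLocal G r C)

-- Give vertex index k a partial assignment of the m bicliques of the cover: a biclique is
-- fixed to true (false) if u^k or v^k lies on its first (second) side, and left free
-- otherwise; u^k and v^k are non-adjacent, so they never lie on opposite sides. Only the at
-- most 2r bicliques containing u^k or v^k are fixed, so the subcube of {0,1}^m described by
-- the assignment has at least 2^(m-2r) points. A biclique covering the edge u^i v^j is fixed
-- to opposite values by i and j, so the t subcubes are pairwise disjoint and
-- t · 2^(m-2r) ≤ 2^m, i.e. ⌈log t⌉ ≤ 2r.
module Submission where

open import Defs
open import Data.Nat using (ℕ; zero; suc; _+_; _*_; _^_; _≤_; z≤n; s≤s)
open import Data.Nat.Properties
open import Algebra.Properties.CommutativeSemigroup +-commutativeSemigroup using (interchange; x∙yz≈y∙xz)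
open import Data.Nat.ListAction using (sum)
open import Data.Nat.Logarithm using (⌈log₂_⌉; ⌈log₂⌉-mono-≤; ⌈log₂2^n⌉≡n)
open import Data.Bool using (Bool; true; false; _∨_; if_then_else_)
open import Data.Bool.Properties using (∨-zeroʳ; ∨-conicalˡ; ∨-conicalʳ; ¬-not)
open import Data.Maybe using (Maybe; just; nothing)
open import Data.Vec as Vec using (Vec; []; _∷_; fromList)
open import Data.List as List using (List; []; _∷_; length; filterᵇ; map)
open import Data.List.Properties using (length-tabulate)
open import Data.List.Relation.Unary.All as All using (All; []; _∷_)
import Data.List.Relation.Unary.All.Properties as All
open import Data.List.Relation.Unary.AllPairs using (AllPairs; []; _∷_)
import Data.List.Relation.Unary.AllPairs.Properties as AllPairs
open import Data.List.Relation.Unary.Any using (here; there)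
open import Data.List.Membership.Propositional using (_∈_)
open import Data.Fin using (Fin)
open import Data.Sum using (inj₁; inj₂)
open import Data.Product using (_,_)
open import Relation.Nullary using (¬_; Dec; yes; no; contradiction)
open import Relation.Binary.PropositionalEquality

private variable
  m K : ℕ
  b c : Bool
  h h′ : Maybe Bool

-- A subcube of {0,1}^m, given by fixing some coordinates; nothing marks a free coordinate.
Subcube : ℕ → Set
Subcube = Vec (Maybe Bool)

data Disjoint : Subcube m → Subcube m → Set where
  here  : {v w : Subcube m} → ¬ b ≡ c → Disjoint (just b ∷ v) (just c ∷ w)
  there : {v w : Subcube m} → Disjoint v w → Disjoint (h ∷ v) (h′ ∷ w)

dim : Subcube m → ℕ
dim []            = 0
dim (nothing ∷ v) = suc (dim v)
dim (just _ ∷ v)  = dim v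

codim : Subcube m → ℕ
codim []            = 0
codim (nothing ∷ v) = codim v
codim (just _ ∷ v)  = suc (codim v)

codim-∷-≤ : (h : Maybe Bool) {v : Subcube m} → codim (h ∷ v) ≤ suc (codim v)
codim-∷-≤ nothing = n≤1+n _
codim-∷-≤ (just _) = ≤-refl

dim+codim≡ : (v : Subcube m) → dim v + codim v ≡ m
dim+codim≡ []            = refl
dim+codim≡ (nothing ∷ v) = cong suc (dim+codim≡ v)
dim+codim≡ (just _ ∷ v)  = trans (+-suc (dim v) (codim v)) (cong suc (dim+codim≡ v))

volume : Subcube m → ℕ
volume v = 2 ^ dim v

totalVolume : List (Subcube m) → ℕ
totalVolume F = sum (map volume F)

data Meets (b : Bool) : Maybe Bool → Set where
  free  : Meets b nothing
  fixed : Meets b (just b)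

meets? : (b : Bool) (h : Maybe Bool) → Dec (Meets b h)
meets? _     nothing      = yes free
meets? true  (just true)  = yes fixed
meets? false (just false) = yes fixed
meets? true  (just false) = no λ ()
meets? false (just true)  = no λ ()

restrict : Bool → List (Subcube (suc m)) → List (Subcube m)
restrict b [] = []
restrict b ((h ∷ v) ∷ F) with meets? b h
... | yes _ = v ∷ restrict b F
... | no  _ = restrict b F

totalVolume-restrict : (F : List (Subcube (suc m))) →
  totalVolume F ≡ totalVolume (restrict true F) + totalVolume (restrict false F)
totalVolume-restrict [] = refl
totalVolume-restrict ((nothing ∷ v) ∷ F) = begin
  (volume v + (volume v + 0)) + totalVolume F
    ≡⟨ cong₂ _+_ (cong (volume v +_) (+-identityʳ (volume v))) (totalVolume-restrict F) ⟩
  (volume v + volume v) + (totalVolume (restrict true F) + totalVolume (restrict false F))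
    ≡⟨ interchange (volume v) (volume v) _ _ ⟩
  (volume v + totalVolume (restrict true F)) + (volume v + totalVolume (restrict false F)) ∎
  where open ≡-Reasoning
totalVolume-restrict ((just true ∷ v) ∷ F) =
  trans (cong (volume v +_) (totalVolume-restrict F)) (sym (+-assoc (volume v) _ _))
totalVolume-restrict ((just false ∷ v) ∷ F) =
  trans (cong (volume v +_) (totalVolume-restrict F)) (x∙yz≈y∙xz (volume v) (totalVolume (restrict true F)) _)

Disjoint-tail : {v w : Subcube m} → Meets b h → Meets b h′ →
                Disjoint (h ∷ v) (h′ ∷ w) → Disjoint v w
Disjoint-tail fixed fixed (here b≢b) = contradiction refl b≢b
Disjoint-tail _     _     (there d)  = d

restrict-All : {v : Subcube m} {F : List (Subcube (suc m))} → Meets b h →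
               All (Disjoint (h ∷ v)) F → All (Disjoint v) (restrict b F)
restrict-All _ [] = []
restrict-All {b = b} {F = (h′ ∷ _) ∷ _} meets (d ∷ ds) with meets? b h′
... | yes meets′ = Disjoint-tail meets meets′ d ∷ restrict-All meets ds
... | no  _      = restrict-All meets ds

restrict-AllPairs : (b : Bool) {F : List (Subcube (suc m))} →
                    AllPairs Disjoint F → AllPairs Disjoint (restrict b F)
restrict-AllPairs b [] = []
restrict-AllPairs b {(h ∷ _) ∷ _} (ds ∷ dss) with meets? b h
... | yes meets = restrict-All meets ds ∷ restrict-AllPairs b dss
... | no  _     = restrict-AllPairs b dss

disjoint-totalVolume-≤ : (F : List (Subcube m)) → AllPairs Disjoint F → totalVolume F ≤ 2 ^ m
disjoint-totalVolume-≤ {zero} []           _              = z≤n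
disjoint-totalVolume-≤ {zero} ([] ∷ [])    _              = ≤-refl
disjoint-totalVolume-≤ {zero} ([] ∷ [] ∷ _) ((() ∷ _) ∷ _)
disjoint-totalVolume-≤ {suc m} F ds = begin
  totalVolume F                                                  ≡⟨ totalVolume-restrict F ⟩
  totalVolume (restrict true F) + totalVolume (restrict false F)
    ≤⟨ +-mono-≤ (disjoint-totalVolume-≤ _ (restrict-AllPairs true ds))
                (disjoint-totalVolume-≤ _ (restrict-AllPairs false ds)) ⟩
  2 ^ m + 2 ^ m                                                  ≡⟨ cong (2 ^ m +_) (+-identityʳ (2 ^ m)) ⟨
  2 ^ suc m                                                      ∎
  where open ≤-Reasoning

2^≤volume*2^codim : (v : Subcube m) → codim v ≤ K → 2 ^ m ≤ volume v * 2 ^ K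
2^≤volume*2^codim {m} {K} v codim≤K = begin
  2 ^ m                 ≡⟨ cong (2 ^_) (dim+codim≡ v) ⟨
  2 ^ (dim v + codim v) ≤⟨ ^-monoʳ-≤ 2 (+-monoʳ-≤ (dim v) codim≤K) ⟩
  2 ^ (dim v + K)       ≡⟨ ^-distribˡ-+-* 2 (dim v) K ⟩
  volume v * 2 ^ K      ∎
  where open ≤-Reasoning

length*≤sum* : {A : Set} {f : A → ℕ} {c d : ℕ} (xs : List A) →
               All (λ x → c ≤ f x * d) xs → length xs * c ≤ sum (map f xs) * d
length*≤sum* [] [] = z≤n
length*≤sum* {f = f} {c} {d} (x ∷ xs) (c≤ ∷ cs≤) = begin
  c + length xs * c           ≤⟨ +-mono-≤ c≤ (length*≤sum* xs cs≤) ⟩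
  f x * d + sum (map f xs) * d ≡⟨ *-distribʳ-+ d (f x) (sum (map f xs)) ⟨
  sum (map f (x ∷ xs)) * d    ∎
  where open ≤-Reasoning

disjoint-length-≤ : (F : List (Subcube m)) → AllPairs Disjoint F → All (λ v → codim v ≤ K) F →
           length F ≤ 2 ^ K
disjoint-length-≤ {m} {K} F disjoint codim≤K = *-cancelʳ-≤ (length F) (2 ^ K) (2 ^ m) {{m^n≢0 2 m}} (begin
  length F * 2 ^ m      ≤⟨ length*≤sum* F (All.map (λ {v} → 2^≤volume*2^codim v) codim≤K) ⟩
  totalVolume F * 2 ^ K ≤⟨ *-monoˡ-≤ (2 ^ K) (disjoint-totalVolume-≤ F disjoint) ⟩
  2 ^ m * 2 ^ K         ≡⟨ *-comm (2 ^ m) (2 ^ K) ⟩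
  2 ^ K * 2 ^ m         ∎)
  where open ≤-Reasoning

Disjoint-map-fromList : {B : Set} {f g : B → Maybe Bool} (C : List B) {x : B} →
  x ∈ C → f x ≡ just b → g x ≡ just c → ¬ b ≡ c →
  Disjoint (Vec.map f (fromList C)) (Vec.map g (fromList C))
Disjoint-map-fromList (_ ∷ _) (here refl) fx gx b≢c rewrite fx | gx = here b≢c
Disjoint-map-fromList (_ ∷ C) (there x∈C) fx gx b≢c = there (Disjoint-map-fromList C x∈C fx gx b≢c)

codim-map-fromList-≤ : {B : Set} {f : B → Maybe Bool} (p q : B → Bool) →
  (∀ x → p x ≡ false → q x ≡ false → f x ≡ nothing) → (C : List B) →
  codim (Vec.map f (fromList C)) ≤ length (filterᵇ p C) + length (filterᵇ q C)
codim-map-fromList-≤ p q free-outside [] = z≤n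
codim-map-fromList-≤ {f = f} p q free-outside (x ∷ C)
  with ih ← codim-map-fromList-≤ p q free-outside C | p x in px | q x in qx
... | true  | true  = ≤-trans (codim-∷-≤ (f x)) (s≤s (≤-trans ih (+-monoʳ-≤ _ (n≤1+n _))))
... | true  | false = ≤-trans (codim-∷-≤ (f x)) (s≤s ih)
... | false | true  = ≤-trans (codim-∷-≤ (f x)) (≤-trans (s≤s ih) (≤-reflexive (sym (+-suc _ _))))
... | false | false rewrite free-outside x px qx = ih

module _ {n : ℕ} where

  owner : V (Crown n) → Fin n
  owner (inj₁ k) = k
  owner (inj₂ k) = k

  same-owner-nonadjacent : (x y : V (Crown n)) → owner x ≡ owner y → ¬ CrownAdj n x y
  same-owner-nonadjacent (inj₁ _) (inj₁ _) _    ()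
  same-owner-nonadjacent (inj₁ _) (inj₂ _) same adj = adj same
  same-owner-nonadjacent (inj₂ _) (inj₁ _) same adj = adj (sym same)
  same-owner-nonadjacent (inj₂ _) (inj₂ _) _    ()

  side : Biclique (Crown n) → Fin n → Maybe Bool
  side β k = if sideA β (inj₁ k) ∨ sideA β (inj₂ k) then just true
             else if sideB β (inj₁ k) ∨ sideB β (inj₂ k) then just false
             else nothing

  side-A : (β : Biclique (Crown n)) (x : V (Crown n)) → sideA β x ≡ true → side β (owner x) ≡ just true
  side-A β (inj₁ k) xA rewrite xA = refl
  side-A β (inj₂ k) xA rewrite xA | ∨-zeroʳ (sideA β (inj₁ k)) = refl

  sideA-false : (β : Biclique (Crown n)) {x y : V (Crown n)} →
                sideB β y ≡ true → owner x ≡ owner y → sideA β x ≡ false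
  sideA-false β {x} {y} yB same = ¬-not λ xA → same-owner-nonadjacent x y same (complete β x y xA yB)

  side-B : (β : Biclique (Crown n)) (y : V (Crown n)) → sideB β y ≡ true → side β (owner y) ≡ just false
  side-B β (inj₁ k) yB
    rewrite sideA-false β {inj₁ k} yB refl | sideA-false β {inj₂ k} yB refl | yB = refl
  side-B β (inj₂ k) yB
    rewrite sideA-false β {inj₁ k} yB refl | sideA-false β {inj₂ k} yB refl | yB
          | ∨-zeroʳ (sideB β (inj₁ k)) = refl

  side-nothing : (β : Biclique (Crown n)) (k : Fin n) →
                 inB β (inj₁ k) ≡ false → inB β (inj₂ k) ≡ false → side β k ≡ nothing
  side-nothing β k uOut vOut
    rewrite ∨-conicalˡ (sideA β (inj₁ k)) _ uOut | ∨-conicalʳ _ (sideB β (inj₁ k)) uOut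
          | ∨-conicalˡ (sideA β (inj₂ k)) _ vOut | ∨-conicalʳ _ (sideB β (inj₂ k)) vOut = refl

  signature : (C : List (Biclique (Crown n))) → Fin n → Subcube (length C)
  signature C k = Vec.map (λ β → side β k) (fromList C)

  signature-disjoint : (C : List (Biclique (Crown n))) → IsBicliqueCover (Crown n) C →
                       {i j : Fin n} → ¬ i ≡ j → Disjoint (signature C i) (signature C j)
  signature-disjoint C cover {i} {j} i≢j with cover (inj₁ i) (inj₂ j) i≢j
  ... | β , β∈C , inj₁ (uA , vB) = Disjoint-map-fromList C β∈C (side-A β _ uA) (side-B β _ vB) λ ()
  ... | β , β∈C , inj₂ (vA , uB) = Disjoint-map-fromList C β∈C (side-B β _ uB) (side-A β _ vA) λ ()

  signature-codim-≤ : {r : ℕ} (C : List (Biclique (Crown n))) → IsLocal (Crown n) r C →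
                      (k : Fin n) → codim (signature C k) ≤ 2 * r
  signature-codim-≤ {r} C local k = begin
    codim (signature C k)
      ≤⟨ codim-map-fromList-≤ (λ β → inB β (inj₁ k)) (λ β → inB β (inj₂ k)) (λ β → side-nothing β k) C ⟩
    length (filterᵇ (λ β → inB β (inj₁ k)) C) + length (filterᵇ (λ β → inB β (inj₂ k)) C)
      ≤⟨ +-mono-≤ (local (inj₁ k)) (local (inj₂ k)) ⟩
    r + r ≡⟨ cong (r +_) (+-identityʳ r) ⟨
    2 * r ∎
    where open ≤-Reasoning

  crown-size-≤ : {r : ℕ} → HasLocalCover (Crown n) r → n ≤ 2 ^ (2 * r)
  crown-size-≤ (C , cover , local) = subst (_≤ _) (length-tabulate (signature C))
    (disjoint-length-≤ (List.tabulate (signature C))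
              (AllPairs.tabulate⁺ (signature-disjoint C cover))
              (All.tabulate⁺ (signature-codim-≤ C local)))

mainTheorem7 : (t : ℕ) → (r : ℕ) → HasLocalCover (Crown (suc t)) r
    → ⌈log₂ (suc t) ⌉ ≤ 2 * r
mainTheorem7 t r cover = begin
  ⌈log₂ (suc t) ⌉       ≤⟨ ⌈log₂⌉-mono-≤ (crown-size-≤ cover) ⟩
  ⌈log₂ (2 ^ (2 * r)) ⌉ ≡⟨ ⌈log₂2^n⌉≡n (2 * r) ⟩
  2 * r                 ∎
  where open ≤-Reasoning
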